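{- If $(p,R)$ is any mesh pattern, of length not longer than $m$, that occurs in a permutation in $A$, then there exists a $(p,R')$ in the output of $\mathrm{Mine}(A,m)$ such that $R \subseteq R'$.
   Context: Permutations are written in one-line notation. For a word $w$ of distinct integers, $\mathrm{fl}(w)$ (the flattening) is the permutation obtained by replacing the $i$th smallest letter of $w$ by $i$. A mesh pattern $(p,R)$ consists of a classical pattern $p$ of length $k$ together with a set $R \subseteq \{0,\dots,k\}\times\{0,\dots,k\}$ of shaded squares; an occurrence of $(p,R)$ in a permutation $\pi$ is an occurrence of $p$ in $\pi$ such that no letters of $\pi$ lie in the regions corresponding to the shaded squares. The algorithm $\mathrm{Mine}$ takes as input a finite set $A$ of permutations and a positive integer $m$ (an upper bound on the length of patterns to search for), and works as follows. Initialize $S = \{(p,\mathrm{sh}_p) : p$ a classical pattern of length at most $m\}$ with every $\mathrm{sh}_p = \emptyset$. For each $\pi \in A$ and each (not necessarily consecutive) subword $s$ of $\pi$ of length at most $m$: let $p = \mathrm{fl}(s)$ and let $R$ be the maximal shading of $p$ such that $s$ is still an occurrence of the mesh pattern $(p,R)$ in $\pi$; if $R \nsubseteq T$ for all shadings $T \in \mathrm{sh}_p$, add $R$ to $\mathrm{sh}_p$ (only maximal shadings are kept, shadings that become contained in a newly added one being discarded as redundant). The output is the list $S$ of pairs $(p,\mathrm{sh}_p)$; saying $(p,R')$ is in the output means $R' \in \mathrm{sh}_p$. -}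

module Defs where

open import Data.Bool using (Bool; true; false; if_then_else_)
open import Data.Nat using (ℕ; zero; suc; _<?_; _≤?_; _≤_; _≟_)
open import Data.Product using (_×_; _,_; proj₁; proj₂; Σ; ∃)
open import Data.List using (List; []; _∷_; map; filter; length; zip; upTo; foldl; cartesianProduct; _++_)
open import Data.List.Relation.Unary.Any using (any?)
open import Data.List.Relation.Binary.Permutation.Propositional using (_↭_)
open import Data.List.Membership.Propositional using (_∈_; _∉_)
import Data.List.Properties as LP
import Data.Product.Properties as PP
open import Relation.Nullary using (¬?; does)
open import Relation.Binary.Definitions using (DecidableEquality)
open import Relation.Binary.PropositionalEquality using (_≡_)

IsPerm : List ℕ → Set
IsPerm π = π ↭ map suc (upTo (length π))

-- flattening: the i-th smallest letter is replaced by i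
-- (letter x becomes 1 + #{letters of w smaller than x})
fl : List ℕ → List ℕ
fl w = map (λ x → suc (length (filter (_<? x) w))) w

-- Subwords are described by a selection mask (one Bool per position)

subword : List Bool → List ℕ → List ℕ
subword (true  ∷ bs) (x ∷ xs) = x ∷ subword bs xs
subword (false ∷ bs) (x ∷ xs) = subword bs xs
subword _ _ = []

count : List Bool → ℕ
count [] = 0
count (true ∷ bs) = suc (count bs)
count (false ∷ bs) = count bs

masks : ℕ → List (List Bool)
masks zero = [] ∷ []
masks (suc n) = map (false ∷_) (masks n) ++ map (true ∷_) (masks n)

-- positions (0-based) of π paired with values
indexed : List ℕ → List (ℕ × ℕ)
indexed π = zip (upTo (length π)) π

selPos : List Bool → List ℕ → List ℕ
selPos mask π = subword mask (upTo (length π))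

Square : Set
Square = ℕ × ℕ

Shading : Set
Shading = List Square

_≟sq_ : DecidableEquality Square
_≟sq_ = PP.≡-dec _≟_ _≟_

_≟sh_ : DecidableEquality Shading
_≟sh_ = LP.≡-dec _≟sq_

open import Data.List.Relation.Binary.Subset.DecPropositional _≟sq_ using (_⊆_; _⊆?_)

-- The square of the mesh diagram (relative to the occurrence given by
-- `mask`) containing the non-occurrence point (x , v) of π:
-- column a = #{occurrence positions < x}, row b = #{occurrence values < v},
-- i.e. i_a < x < i_{a+1} and v_b < π_x < v_{b+1}.
squareOf : List Bool → List ℕ → ℕ × ℕ → Square
squareOf mask π (x , v) =
  length (filter (_<? x) (selPos mask π)) , length (filter (_<? v) (subword mask π))

occupied : List Bool → List ℕ → List Square
occupied mask π = go (zip mask (indexed π))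
  where
  go : List (Bool × (ℕ × ℕ)) → List Square
  go [] = []
  go ((true , _) ∷ r) = go r
  go ((false , xv) ∷ r) = squareOf mask π xv ∷ go r

IsMeshOccurrence : List ℕ → Shading → List ℕ → List Bool → Set
IsMeshOccurrence p R π mask =
  (length mask ≡ length π) × (fl (subword mask π) ≡ p) ×
  (∀ {sq} → sq ∈ R → sq ∉ occupied mask π)

MeshOccurs : List ℕ → Shading → List ℕ → Set
MeshOccurs p R π = ∃ λ mask → IsMeshOccurrence p R π mask

-- maximal shading of p = fl(s) such that s is still an occurrence:
-- all squares in {0..k}×{0..k} containing no point of π
maxShading : List Bool → List ℕ → Shading
maxShading mask π =
  filter (λ sq → ¬? (sq ∈? occupied mask π))
         (cartesianProduct (upTo (suc k)) (upTo (suc k)))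
  where
  k = count mask
  open import Data.List.Membership.DecPropositional _≟sq_ using (_∈?_)

-- sh_p for every classical pattern p (initially empty for all p)
Table : Set
Table = List ℕ → List Shading

insertShading : Shading → List Shading → List Shading
insertShading R ts =
  if does (any? (R ⊆?_) ts) then ts
  else R ∷ filter (λ T → ¬? (T ⊆? R)) ts

update : Table → List ℕ → Shading → Table
update tbl p R q = if does (LP.≡-dec _≟_ q p) then insertShading R (tbl p) else tbl q

processPerm : ℕ → Table → List ℕ → Table
processPerm m tbl π =
  foldl (λ t mask → update t (fl (subword mask π)) (maxShading mask π)) tbl
        (filter (λ mask → count mask ≤? m) (masks (length π)))

Mine : List (List ℕ) → ℕ → Table
Mine A m = foldl (processPerm m) (λ _ → []) A

module Submission where

-- Call a shading S of p "covered" by a table if some shading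
-- stored for p contains S.  Mine folds two kinds of updates over its
-- input, and both interact well with coverage:
--   * every update only ever replaces a stored shading by a larger one,
--     so coverage is never lost (an invariant of the fold);
--   * updating p with R makes R covered.
-- Hence, by a general fact about left folds, coverage of (p , R) holds in
-- the output as soon as one step of the fold establishes it.  If s is a
-- mesh occurrence of (p , R) in π ∈ A, its mask is among those processed
-- for π (it has length |π| and at most m letters), the step for that mask
-- covers the maximal shading of the occurrence, and R is contained in
-- that maximal shading: its squares lie in {0..|p|}² and are unoccupied.

open import Defs
open import Data.Nat using (ℕ; suc; _≤_; s≤s; _≤?_; _≟_)
open import Data.Nat.Properties using (suc-injective)
open import Data.Bool using (Bool; true; false)
open import Data.Product using (_×_; _,_; proj₁; proj₂; ∃)
open import Data.List using (List; length; []; _∷_; foldl; map; filter; upTo; cartesianProduct)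
open import Data.List.Relation.Unary.All using (All)
import Data.List.Relation.Unary.All as All
open import Data.List.Relation.Unary.Any using (Any; here; there; any?)
import Data.List.Relation.Unary.Any as Any
open import Data.List.Membership.Propositional using (_∈_; _∉_; find; lose)
open import Data.List.Membership.Propositional.Properties
  using (∈-map⁺; ∈-++⁺ˡ; ∈-++⁺ʳ; ∈-filter⁺; ∈-cartesianProduct⁺; ∈-upTo⁺)
open import Data.List.Relation.Binary.Subset.Propositional using (_⊆_)
import Data.List.Properties as LP
open import Relation.Nullary using (yes; no; ¬?)
open import Relation.Binary.PropositionalEquality using (_≡_; refl; sym; cong; subst; module ≡-Reasoning)
open import Data.List.Membership.DecPropositional _≟sq_ using (_∈?_)
open import Data.List.Relation.Binary.Subset.DecPropositional _≟sq_ using (_⊆?_)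

Preserved : {B X : Set} → (B → X → B) → (B → Set) → Set
Preserved f P = ∀ b x → P b → P (f b x)

foldl-preserves : {B X : Set} {f : B → X → B} {P : B → Set} → Preserved f P →
  ∀ xs b → P b → P (foldl f b xs)
foldl-preserves pres []       b Pb = Pb
foldl-preserves pres (x ∷ xs) b Pb = foldl-preserves pres xs _ (pres b x Pb)

foldl-establishes : {B X : Set} {f : B → X → B} {P : B → Set} → Preserved f P →
  ∀ xs → Any (λ x → ∀ b → P (f b x)) xs → ∀ b → P (foldl f b xs)
foldl-establishes pres (x ∷ xs) (here est) b = foldl-preserves pres xs _ (est b)
foldl-establishes pres (x ∷ xs) (there a)  b = foldl-establishes pres xs a _

Covered : Shading → List ℕ → Table → Set
Covered S p tbl = ∃ λ T → (T ∈ tbl p) × (S ⊆ T)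

covered-⊆ : ∀ {S S' p tbl} → S ⊆ S' → Covered S' p tbl → Covered S p tbl
covered-⊆ S⊆S' (T , T∈ , S'⊆T) = T , T∈ , (λ x → S'⊆T (S⊆S' x))

-- insertShading only discards shadings contained in the one it adds.
insert-preserves : ∀ R ts {S T} → T ∈ ts → S ⊆ T →
  ∃ λ T' → (T' ∈ insertShading R ts) × (S ⊆ T')
insert-preserves R ts {S} {T} T∈ S⊆T with any? (R ⊆?_) ts
... | yes _ = T , T∈ , S⊆T
... | no _ with T ⊆? R
...   | yes T⊆R = R , here refl , (λ x → T⊆R (S⊆T x))
...   | no T⊈R = T , there (∈-filter⁺ (λ T → ¬? (T ⊆? R)) T∈ T⊈R) , S⊆T

insert-covers : ∀ R ts → ∃ λ T → (T ∈ insertShading R ts) × (R ⊆ T)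
insert-covers R ts with any? (R ⊆?_) ts
... | yes R⊆some = find R⊆some
... | no _       = R , here refl , (λ x → x)

update-preserves : ∀ S p q R tbl → Covered S p tbl → Covered S p (update tbl q R)
update-preserves S p q R tbl (T , T∈ , S⊆T) with LP.≡-dec _≟_ p q
... | yes refl = insert-preserves R (tbl p) T∈ S⊆T
... | no _     = T , T∈ , S⊆T

update-covers : ∀ p R tbl → Covered R p (update tbl p R)
update-covers p R tbl with LP.≡-dec _≟_ p p
... | yes refl = insert-covers R (tbl p)
... | no p≢p with () ← p≢p refl

-- processPerm m tbl π is the fold of maskStep π over processedMasks m π.
maskStep : List ℕ → Table → List Bool → Table
maskStep π tbl mask = update tbl (fl (subword mask π)) (maxShading mask π)

processedMasks : ℕ → List ℕ → List (List Bool)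
processedMasks m π = filter (λ mask → count mask ≤? m) (masks (length π))

processPerm-preserves : ∀ S p m → Preserved (processPerm m) (Covered S p)
processPerm-preserves S p m tbl π =
  foldl-preserves {f = maskStep π}
    (λ t mask → update-preserves S p (fl (subword mask π)) (maxShading mask π) t)
    (processedMasks m π) tbl

masks-complete : ∀ bs → bs ∈ masks (length bs)
masks-complete [] = here refl
masks-complete (false ∷ bs) = ∈-++⁺ˡ (∈-map⁺ (false ∷_) (masks-complete bs))
masks-complete (true ∷ bs) =
  ∈-++⁺ʳ (map (false ∷_) (masks (length bs))) (∈-map⁺ (true ∷_) (masks-complete bs))

count-length : ∀ mask (π : List ℕ) → length mask ≡ length π →
  count mask ≡ length (subword mask π)
count-length []           []       _ = refl
count-length (true ∷ bs)  (_ ∷ xs) e = cong suc (count-length bs xs (suc-injective e))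
count-length (false ∷ bs) (_ ∷ xs) e = count-length bs xs (suc-injective e)

processPerm-covers : ∀ m π mask → length mask ≡ length π → count mask ≤ m →
  ∀ tbl → Covered (maxShading mask π) (fl (subword mask π)) (processPerm m tbl π)
processPerm-covers m π mask lenEq cnt≤m =
  foldl-establishes {f = maskStep π}
    (λ t mask' → update-preserves _ _ (fl (subword mask' π)) (maxShading mask' π) t)
    (processedMasks m π)
    (lose mask-processed (update-covers (fl (subword mask π)) (maxShading mask π)))
  where
  mask-processed : mask ∈ processedMasks m π
  mask-processed = ∈-filter⁺ (λ mask → count mask ≤? m)
    (subst (λ n → mask ∈ masks n) lenEq (masks-complete mask)) cnt≤m

Bounded : ℕ → Shading → Set
Bounded k R = All (λ sq → (proj₁ sq ≤ k) × (proj₂ sq ≤ k)) R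

maxShading-maximal : ∀ mask π R → Bounded (count mask) R →
  (∀ {sq} → sq ∈ R → sq ∉ occupied mask π) → R ⊆ maxShading mask π
maxShading-maximal mask π R bounded unoccupied {sq} sq∈R =
  ∈-filter⁺ (λ sq → ¬? (sq ∈? occupied mask π)) inGrid (unoccupied sq∈R)
  where
  k = count mask
  inGrid : sq ∈ cartesianProduct (upTo (suc k)) (upTo (suc k))
  inGrid = let (i≤k , j≤k) = All.lookup bounded sq∈R
           in ∈-cartesianProduct⁺ (∈-upTo⁺ (s≤s i≤k)) (∈-upTo⁺ (s≤s j≤k))

occurrence-count : ∀ {p R π mask} → IsMeshOccurrence p R π mask → count mask ≡ length p
occurrence-count {p} {π = π} {mask} (lenEq , flEq , _) = begin
  count mask                   ≡⟨ count-length mask π lenEq ⟩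
  length (subword mask π)      ≡⟨ sym (LP.length-map _ (subword mask π)) ⟩
  length (fl (subword mask π)) ≡⟨ cong length flEq ⟩
  length p                     ∎
  where open ≡-Reasoning

occurrence-covered : ∀ m p R π → length p ≤ m → Bounded (length p) R →
  MeshOccurs p R π → ∀ tbl → Covered R p (processPerm m tbl π)
occurrence-covered m p R π p≤m bounded (mask , occ@(lenEq , flEq , unoccupied)) tbl =
  covered-⊆ {p = p} {tbl = after} R⊆max max-covered
  where
  after : Table
  after = processPerm m tbl π
  k≡|p| : count mask ≡ length p
  k≡|p| = occurrence-count {p} {R} {π} {mask} occ
  max-covered : Covered (maxShading mask π) p after
  max-covered = subst (λ q → Covered (maxShading mask π) q after) flEq
    (processPerm-covers m π mask lenEq (subst (_≤ m) (sym k≡|p|) p≤m) tbl)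
  R⊆max : R ⊆ maxShading mask π
  R⊆max = maxShading-maximal mask π R (subst (λ k → Bounded k R) (sym k≡|p|) bounded) unoccupied

lemma2p1 : (A : List (List ℕ)) (m : ℕ) → 1 ≤ m → All IsPerm A →
    (p : List ℕ) (R : Shading) → length p ≤ m →
    All (λ sq → (proj₁ sq ≤ length p) × (proj₂ sq ≤ length p)) R →
    Any (MeshOccurs p R) A →
    ∃ λ R' → (R' ∈ Mine A m p) × (R ⊆ R')
lemma2p1 A m _ _ p R p≤m bounded occurs =
  foldl-establishes (processPerm-preserves R p m) A
    (Any.map (occurrence-covered m p R _ p≤m bounded) occurs) (λ _ → [])
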